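{- Let $k\ge3$ and let $n$ be a positive integer. Then $W^{(k)}_n$ contains no bordering square.
   Context: Words are over $\mathbb{N}$. Define the morphism $\varphi_k$ by $\varphi_k(ki+j)=(ki)(ki+j+1)$ if $0\le j\le k-2$ and $\varphi_k(ki+j)=(ki+j+1)$ if $j=k-1$; let $W^{(k)}_n=\varphi_k^n(0)$. It is known that $W^{(k)}_n=W^{(k)}_{n-1}\cdots W^{(k)}_0\,n$ for $1\le n\le k-1$ and $W^{(k)}_n=W^{(k)}_{n-1}\cdots W^{(k)}_{n-k+1}(k\oplus W^{(k)}_{n-k})$ for $n\ge k$, where $k\oplus U$ adds $k$ to every digit of $U$. Let $m=\max\{0,n-k+1\}$. For an integer $j$ with $\max\{0,n-k+1\}\le j\le n-1$, a factor $A$ of $W^{(k)}_n$ is a bordering factor of type $j$ if the two-digit word $j0$ is a factor of $A$ and $A$ is a factor of $W^{(k)}_jW^{(k)}_{j-1}\cdots W^{(k)}_m$. A bordering square of $W^{(k)}_n$ is a bordering factor (of some type) that is a square, i.e. of the form $UU$ with $U$ nonempty. -}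

module Defs where

open import Data.Nat using (ℕ; zero; suc; _+_; _*_; _∸_; _<ᵇ_; _≤_; _<_)
open import Data.Nat.DivMod using (_%_)
open import Data.Bool using (if_then_else_)
open import Data.List using (List; []; _∷_; _++_; concatMap)
open import Data.Product using (∃; ∃-syntax; _×_; _,_)
open import Data.Nat.Base using (NonZero)

Word : Set
Word = List ℕ

-- image of the letter a = k*i + j (0 ≤ j ≤ k-1) under φ_k:
--   (k*i) (k*i + j + 1)  if j ≤ k-2,   (k*i + j + 1)  if j = k-1.
-- Here k*i = a ∸ (a % k). The case k = 0 is meaningless and never used (k ≥ 3).
phiLetter : ℕ → ℕ → Word
phiLetter zero    a = suc a ∷ []
phiLetter (suc k') a =
  if suc (a % suc k') <ᵇ suc k'
  then (a ∸ (a % suc k')) ∷ suc a ∷ []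
  else suc a ∷ []

phi : ℕ → Word → Word
phi k = concatMap (phiLetter k)

phiIter : ℕ → ℕ → Word → Word
phiIter k zero    w = w
phiIter k (suc n) w = phi k (phiIter k n w)

W : ℕ → ℕ → Word
W k n = phiIter k n (0 ∷ [])

Factor : Word → Word → Set
Factor A B = ∃[ u ] ∃[ v ] (B ≡ u ++ A ++ v)
  where open import Relation.Binary.PropositionalEquality using (_≡_)

WcatFrom : ℕ → ℕ → ℕ → Word
WcatFrom k m zero    = W k m
WcatFrom k m (suc d) = W k (m + suc d) ++ WcatFrom k m d

-- Wcat k j m = W_j W_{j-1} ⋯ W_m   (used only when m ≤ j)
Wcat : ℕ → ℕ → ℕ → Word
Wcat k j m = WcatFrom k m (j ∸ m)

-- m = max{0, n-k+1} = n ∸ (k ∸ 1)   (for k ≥ 1)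
lowIdx : ℕ → ℕ → ℕ
lowIdx k n = n ∸ (k ∸ 1)

BorderingFactor : ℕ → ℕ → ℕ → Word → Set
BorderingFactor k n j A =
  Factor A (W k n) ×
  lowIdx k n ≤ j × j < n ×
  Factor (j ∷ 0 ∷ []) A ×
  Factor A (Wcat k j (lowIdx k n))

IsSquare : Word → Set
IsSquare A = ∃[ U ] (U ≢ [] × A ≡ U ++ U)
  where open import Relation.Binary.PropositionalEquality using (_≡_; _≢_)

module Submission where

open import Defs
open import Data.Bool using (true; false)
open import Data.List using ([]; _∷_; _++_; [_]; length; filter)
open import Data.List.Properties using (length-++; filter-++; filter-none; filter-accept; filter-reject)
open import Data.List.Relation.Unary.All as All using (All; []; _∷_)
open import Data.List.Relation.Unary.All.Properties using (++⁺)
open import Data.Nat using (ℕ; zero; suc; _+_; _∸_; _≤_; _<_; _<ᵇ_; z≤n; s≤s)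
open import Data.Nat.DivMod using (_%_)
open import Data.Nat.Properties
open import Data.Product using (∃-syntax; _×_; _,_)
open import Function using (_∘_)
open import Relation.Binary.PropositionalEquality using (_≡_; _≢_; refl; sym; trans; cong; cong₂; subst; module ≡-Reasoning)
open import Relation.Nullary using (¬_; yes; no)

-- The letter j occurs in A but only once in W_j W_{j-1} ⋯ W_m ⊇ A, whereas a
-- square contains every letter an even number of times.  The single
-- occurrence comes from an invariant of φ_k: the image of a letter a is a word
-- ending in a + 1 whose other letters are at most a, so if t is the largest
-- letter of w and occurs once there, then t + 1 is the largest letter of φ_k(w)
-- and occurs once there.  Hence t is the largest letter of W_t, occurring once,
-- and W_{t'} for t' < j does not contain j at all.

occ : ℕ → Word → ℕ
occ x w = length (filter (x ≟_) w)

occ-++ : ∀ x u v → occ x (u ++ v) ≡ occ x u + occ x v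
occ-++ x u v = trans (cong length (filter-++ (x ≟_) u v)) (length-++ (filter (x ≟_) u))

occ-≡0 : ∀ {x w} → All (_< x) w → occ x w ≡ 0
occ-≡0 {x} w<x =
  cong length (filter-none (x ≟_) (All.map (λ y<x x≡y → <-irrefl (sym x≡y) y<x) w<x))

occ-head : ∀ x w → 1 ≤ occ x (x ∷ w)
occ-head x w rewrite filter-accept (x ≟_) {x} {w} refl = s≤s z≤n

occ-Factor : ∀ x {A B} → Factor A B → occ x A ≤ occ x B
occ-Factor x {A} (u , v , refl) = begin
  occ x A                     ≤⟨ m≤m+n (occ x A) (occ x v) ⟩
  occ x A + occ x v           ≡⟨ occ-++ x A v ⟨
  occ x (A ++ v)              ≤⟨ m≤n+m (occ x (A ++ v)) (occ x u) ⟩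
  occ x u + occ x (A ++ v)    ≡⟨ occ-++ x u (A ++ v) ⟨
  occ x (u ++ A ++ v)         ∎
  where open ≤-Reasoning

occ-suc-singleton : ∀ t a → occ (suc t) [ suc a ] ≡ occ t [ a ]
occ-suc-singleton t a with t ≟ a
... | yes refl = trans (cong length (filter-accept (suc t ≟_) refl))
                      (sym (cong length (filter-accept (t ≟_) refl)))
... | no t≢a   = trans (cong length (filter-reject (suc t ≟_) (t≢a ∘ suc-injective)))
                      (sym (cong length (filter-reject (t ≟_) t≢a)))

m+m≢1 : ∀ m → m + m ≢ 1
m+m≢1 (suc m) eq rewrite +-suc m m with eq
... | ()

occ-square≢1 : ∀ x {A} → IsSquare A → occ x A ≢ 1
occ-square≢1 x (U , _ , refl) eq = m+m≢1 (occ x U) (trans (sym (occ-++ x U U)) eq)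

unique-letter⇒¬square : ∀ {x A B} → 1 ≤ occ x A → Factor A B → occ x B ≡ 1 → ¬ IsSquare A
unique-letter⇒¬square {x} x∈A A⊑B occB≡1 sq =
  occ-square≢1 x sq (≤-antisym (subst (_ ≤_) occB≡1 (occ-Factor x A⊑B)) x∈A)

phiLetter-shape : ∀ k a → ∃[ p ] phiLetter k a ≡ p ++ [ suc a ] × All (_≤ a) p
phiLetter-shape zero a = [] , refl , []
phiLetter-shape (suc k) a with suc (a % suc k) <ᵇ suc k
... | true  = [ a ∸ a % suc k ] , refl , m∸n≤m a (a % suc k) ∷ []
... | false = [] , refl , []

phiLetter-bounded : ∀ k {a t} → a ≤ t → All (_≤ suc t) (phiLetter k a)
phiLetter-bounded k {a} a≤t with phiLetter-shape k a
... | p , eq , p≤a rewrite eq =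
  ++⁺ (All.map (λ b≤a → m≤n⇒m≤1+n (≤-trans b≤a a≤t)) p≤a) (s≤s a≤t ∷ [])

occ-suc-phiLetter : ∀ k {a t} → a ≤ t → occ (suc t) (phiLetter k a) ≡ occ t [ a ]
occ-suc-phiLetter k {a} {t} a≤t with phiLetter-shape k a
... | p , eq , p≤a rewrite eq = begin
  occ (suc t) (p ++ [ suc a ])              ≡⟨ occ-++ (suc t) p [ suc a ] ⟩
  occ (suc t) p + occ (suc t) [ suc a ]     ≡⟨ cong₂ _+_ (occ-≡0 p<1+t) (occ-suc-singleton t a) ⟩
  occ t [ a ]                               ∎
  where
  open ≡-Reasoning
  p<1+t : All (_< suc t) p
  p<1+t = All.map (λ b≤a → s≤s (≤-trans b≤a a≤t)) p≤a

phi-bounded : ∀ k {t w} → All (_≤ t) w → All (_≤ suc t) (phi k w)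
phi-bounded k []           = []
phi-bounded k (a≤t ∷ w≤t) = ++⁺ (phiLetter-bounded k a≤t) (phi-bounded k w≤t)

occ-suc-phi : ∀ k {t w} → All (_≤ t) w → occ (suc t) (phi k w) ≡ occ t w
occ-suc-phi k []                        = refl
occ-suc-phi k {t} {a ∷ w} (a≤t ∷ w≤t) = begin
  occ (suc t) (phiLetter k a ++ phi k w)          ≡⟨ occ-++ (suc t) (phiLetter k a) (phi k w) ⟩
  occ (suc t) (phiLetter k a) + occ (suc t) (phi k w)
                                                  ≡⟨ cong₂ _+_ (occ-suc-phiLetter k a≤t) (occ-suc-phi k w≤t) ⟩
  occ t [ a ] + occ t w                           ≡⟨ occ-++ t [ a ] w ⟨
  occ t (a ∷ w)                                   ∎
  where open ≡-Reasoning

W-bounded : ∀ k t → All (_≤ t) (W k t)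
W-bounded k zero    = z≤n ∷ []
W-bounded k (suc t) = phi-bounded k (W-bounded k t)

occ-W : ∀ k t → occ t (W k t) ≡ 1
occ-W k zero    = refl
occ-W k (suc t) = trans (occ-suc-phi k (W-bounded k t)) (occ-W k t)

WcatFrom-bounded : ∀ k m d → All (_≤ m + d) (WcatFrom k m d)
WcatFrom-bounded k m zero    rewrite +-identityʳ m = W-bounded k m
WcatFrom-bounded k m (suc d) =
  ++⁺ (W-bounded k (m + suc d))
      (All.map (λ p → ≤-trans p (+-monoʳ-≤ m (n≤1+n d))) (WcatFrom-bounded k m d))

occ-WcatFrom : ∀ k m d → occ (m + d) (WcatFrom k m d) ≡ 1
occ-WcatFrom k m zero    rewrite +-identityʳ m = occ-W k m
occ-WcatFrom k m (suc d) = begin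
  occ t (W k t ++ WcatFrom k m d)          ≡⟨ occ-++ t (W k t) (WcatFrom k m d) ⟩
  occ t (W k t) + occ t (WcatFrom k m d)   ≡⟨ cong₂ _+_ (occ-W k t) (occ-≡0 rest<t) ⟩
  1                                        ∎
  where
  open ≡-Reasoning
  t : ℕ
  t = m + suc d
  rest<t : All (_< t) (WcatFrom k m d)
  rest<t = All.map (λ p → ≤-<-trans p (+-monoʳ-< m (n<1+n d))) (WcatFrom-bounded k m d)

occ-Wcat : ∀ k {j m} → m ≤ j → occ j (Wcat k j m) ≡ 1
occ-Wcat k {j} {m} m≤j = subst (λ i → occ i (Wcat k j m) ≡ 1) (m+[n∸m]≡n m≤j) (occ-WcatFrom k m (j ∸ m))

lemma12 : (k : ℕ) → 3 ≤ k → (n : ℕ) → 1 ≤ n →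
          (j : ℕ) → (A : Word) → BorderingFactor k n j A → ¬ IsSquare A
lemma12 k _ n _ j A (_ , m≤j , _ , j0⊑A , A⊑Wcat) =
  unique-letter⇒¬square (≤-trans (occ-head j [ 0 ]) (occ-Factor j j0⊑A)) A⊑Wcat (occ-Wcat k m≤j)
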